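{- Let $k\ge 1$ and $0\le r<k$ be integers, and let $n\ge 1$ be an integer. Let $$C_n(k,r,x)=\left(\binom{ki+r}{i-j}x^k+\binom{k(i+1)+r}{i-j+1}\right)_{i,j=0}^{n-1}.$$ Then $x^r\det C_n(k,r,x)=L^{(k)}_{kn+r}(x)$.
   Context: Binomial coefficients satisfy $\binom{a}{m}=0$ for $m<0$ (and the usual values otherwise; here all upper indices are nonnegative). For positive integers $k$ and $N$, the generalized Lucas polynomial is $L^{(k)}_N(x)=\sum_{j=0}^{\lfloor N/k\rfloor}\frac{N}{N-(k-1)j}\binom{N-(k-1)j}{j}x^{N-kj}$; equivalently $L^{(k)}_0=k$, $L^{(k)}_N(x)=x^N$ for $0<N<k$, and $L^{(k)}_N(x)=xL^{(k)}_{N-1}(x)+L^{(k)}_{N-k}(x)$ for $N\ge k$. -}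

module Defs where

open import Level using (Level)
open import Data.Nat as ℕ using (ℕ; zero; suc; _∸_; _<ᵇ_)
open import Data.Nat.Combinatorics using (_C_)
open import Data.Integer as ℤ using (ℤ; +_; -[1+_])
open import Data.Fin using (Fin; toℕ; punchIn)
import Data.Fin as Fin
open import Data.Bool using (if_then_else_)
open import Algebra.Bundles using (CommutativeRing)

binomℤ : ℕ → ℤ → ℕ
binomℤ a (+ m)     = a C m
binomℤ a -[1+ _ ]  = 0

module RingDefs {c ℓ : Level} (R : CommutativeRing c ℓ) where
  open CommutativeRing R

  fromℕ : ℕ → Carrier
  fromℕ zero    = 0#
  fromℕ (suc n) = 1# + fromℕ n

  pow : Carrier → ℕ → Carrier
  pow x zero    = 1#
  pow x (suc n) = x * pow x n

  sgn : ℕ → Carrier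
  sgn zero    = 1#
  sgn (suc j) = - sgn j

  ΣFin : (n : ℕ) → (Fin n → Carrier) → Carrier
  ΣFin zero    f = 0#
  ΣFin (suc n) f = f Fin.zero + ΣFin n (λ j → f (Fin.suc j))

  det : (n : ℕ) → (Fin n → Fin n → Carrier) → Carrier
  det zero    A = 1#
  det (suc n) A =
    ΣFin (suc n) (λ j → sgn (toℕ j) * (A Fin.zero j *
      det n (λ i' j' → A (Fin.suc i') (punchIn j j'))))

  Cmat : (k r n : ℕ) → Carrier → Fin n → Fin n → Carrier
  Cmat k r n x i j =
    fromℕ (binomℤ (k ℕ.* toℕ i ℕ.+ r) (+ toℕ i ℤ.- + toℕ j)) * pow x k
    + fromℕ (binomℤ (k ℕ.* suc (toℕ i) ℕ.+ r) ((+ toℕ i ℤ.- + toℕ j) ℤ.+ + 1))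

  -- generalized Lucas polynomial evaluated at x, via the recurrence
  --   L_0 = k, L_N = x^N (0<N<k), L_N = x L_{N-1} + L_{N-k} (N ≥ k).
  -- 'fuel' is an auxiliary recursion bound; lucas uses fuel = N, which suffices.
  lucasF : ℕ → (k N : ℕ) → Carrier → Carrier
  lucasF _          k zero    x = fromℕ k
  lucasF zero       k (suc N) x = 0#   -- unreachable when fuel ≥ N
  lucasF (suc fuel) k (suc N) x =
    if suc N <ᵇ k then pow x (suc N)
    else x * lucasF fuel k N x + lucasF fuel k (suc N ∸ k) x

  lucas : (k N : ℕ) → Carrier → Carrier
  lucas k N x = lucasF N k N x

module Submission where

open import Level using (Level; _⊔_)
open import Algebra.Bundles using (CommutativeRing)
open import Data.Bool using (true; false; if_then_else_; T)
open import Data.Fin as Fin using (Fin; toℕ; punchIn)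
open import Data.Integer as ℤ using (ℤ; +_; -[1+_])
import Data.Integer.Properties as ℤ
open import Data.Nat as ℕ using (ℕ; zero; suc; _≤_; _<_)
open import Data.Nat.Combinatorics using (_C_; nCk+nC[k+1]≡[n+1]C[k+1]; nC1≡n)
open import Data.Nat.Induction using (<-rec)
import Data.Nat.Properties as ℕ
open import Data.Nat.Tactic.RingSolver using (solve-∀)
open import Relation.Binary.PropositionalEquality as ≡ using (_≡_; cong; cong₂; module ≡-Reasoning)
import Relation.Binary.Reasoning.Setoid as SetoidReasoning
open import Relation.Nullary using (contradiction)
open import Defs

-- Write M r for the infinite matrix with entries binom(ki+r, i-j) x^k + binom(k(i+1)+r, i-j+1)
-- and F r n for its leading n×n minor. The matrix M r is lower Hessenberg with unit
-- superdiagonal, and removing its first row and column leaves M (r+k); expanding along the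
-- first column therefore writes F r (n+1) as an alternating sum of the entries of column 0
-- against the minors F (r+(t+1)k) (n-t). Pascal's rule splits column 0 of M (r+1) into
-- columns 0 and 1 of M r, and column 1 of M r is (1, column 0 of M (r+k)), a repeated column;
-- this gives F (r+1) (n+1) = F r (n+1) + F (r+1) n. Binomial absorption gives
-- F 0 (n+1) = x^k F k n + k. After multiplying by x^r these become the recurrence
-- L_N = x L_{N-1} + L_{N-k}.

C-pascal : ∀ n m → suc n C suc m ≡ n C suc m ℕ.+ n C m
C-pascal n m = ≡.trans (≡.sym (nCk+nC[k+1]≡[n+1]C[k+1] n m)) (ℕ.+-comm (n C m) (n C suc m))

[1+m]*[1+n]C[1+m]≡[1+n]*nCm : ∀ n m → suc m ℕ.* (suc n C suc m) ≡ suc n ℕ.* (n C m)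
[1+m]*[1+n]C[1+m]≡[1+n]*nCm zero    zero    = ≡.refl
[1+m]*[1+n]C[1+m]≡[1+n]*nCm zero    (suc m) = ℕ.*-zeroʳ (suc (suc m))
[1+m]*[1+n]C[1+m]≡[1+n]*nCm (suc n) zero    =
  ≡.trans (ℕ.+-identityʳ _) (≡.trans (nC1≡n (suc (suc n))) (≡.sym (ℕ.*-identityʳ (suc (suc n)))))
[1+m]*[1+n]C[1+m]≡[1+n]*nCm (suc n) (suc m) = begin
  suc (suc m) ℕ.* (suc (suc n) C suc (suc m))
    ≡⟨ cong (suc (suc m) ℕ.*_) (C-pascal (suc n) (suc m)) ⟩
  suc (suc m) ℕ.* (b ℕ.+ a)
    ≡⟨ regroup m a b ⟩
  a ℕ.+ (suc m ℕ.* a ℕ.+ suc (suc m) ℕ.* b)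
    ≡⟨ cong (a ℕ.+_) (cong₂ ℕ._+_ ([1+m]*[1+n]C[1+m]≡[1+n]*nCm n m) ([1+m]*[1+n]C[1+m]≡[1+n]*nCm n (suc m))) ⟩
  a ℕ.+ (suc n ℕ.* (n C m) ℕ.+ suc n ℕ.* (n C suc m))
    ≡⟨ cong (a ℕ.+_) (≡.sym (ℕ.*-distribˡ-+ (suc n) (n C m) (n C suc m))) ⟩
  a ℕ.+ suc n ℕ.* (n C m ℕ.+ n C suc m)
    ≡⟨ cong (λ z → a ℕ.+ suc n ℕ.* z) (≡.trans (ℕ.+-comm (n C m) (n C suc m)) (≡.sym (C-pascal n m))) ⟩
  suc (suc n) ℕ.* a ∎
  where
  open ≡-Reasoning
  a b : ℕ
  a = suc n C suc m
  b = suc n C suc (suc m)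
  regroup : ∀ m a b → suc (suc m) ℕ.* (b ℕ.+ a) ≡ a ℕ.+ (suc m ℕ.* a ℕ.+ suc (suc m) ℕ.* b)
  regroup = solve-∀

[[1+k]*[1+m]]C[1+m]≡[1+k]*[[1+k]*m+k]Cm : ∀ k′ m → (suc k′ ℕ.* suc m ℕ.+ 0) C suc m ≡ suc k′ ℕ.* ((suc k′ ℕ.* m ℕ.+ k′) C m)
[[1+k]*[1+m]]C[1+m]≡[1+k]*[[1+k]*m+k]Cm k′ m = ℕ.*-cancelˡ-≡ _ _ (suc m) (begin
  suc m ℕ.* ((suc k′ ℕ.* suc m ℕ.+ 0) C suc m) ≡⟨ cong (λ a → suc m ℕ.* (a C suc m)) (index k′ m) ⟩
  suc m ℕ.* (suc N C suc m)                    ≡⟨ [1+m]*[1+n]C[1+m]≡[1+n]*nCm N m ⟩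
  suc N ℕ.* (N C m)                             ≡⟨ regroup k′ m (N C m) ⟩
  suc m ℕ.* (suc k′ ℕ.* (N C m))               ∎)
  where
  open ≡-Reasoning
  N : ℕ
  N = suc k′ ℕ.* m ℕ.+ k′
  index : ∀ k′ m → suc k′ ℕ.* suc m ℕ.+ 0 ≡ suc (suc k′ ℕ.* m ℕ.+ k′)
  index = solve-∀
  regroup : ∀ k′ m c → suc (suc k′ ℕ.* m ℕ.+ k′) ℕ.* c ≡ suc m ℕ.* (suc k′ ℕ.* c)
  regroup = solve-∀

k*[1+n]+r≡k+[k*n+r] : ∀ k n r → k ℕ.* suc n ℕ.+ r ≡ k ℕ.+ (k ℕ.* n ℕ.+ r)
k*[1+n]+r≡k+[k*n+r] k n r = ≡.trans (cong (ℕ._+ r) (ℕ.*-suc k n)) (ℕ.+-assoc k (k ℕ.* n) r)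

[1+k]*[1+n]+r≡k+[[1+k]*n+[1+r]] : ∀ k n r → suc k ℕ.* suc n ℕ.+ r ≡ k ℕ.+ (suc k ℕ.* n ℕ.+ suc r)
[1+k]*[1+n]+r≡k+[[1+k]*n+[1+r]] = solve-∀

m+n<ᵇm≡false : ∀ m n → (m ℕ.+ n ℕ.<ᵇ m) ≡ false
m+n<ᵇm≡false zero    n = ≡.refl
m+n<ᵇm≡false (suc m) n = m+n<ᵇm≡false m n

binomℤ-pascal : ∀ a w → binomℤ (suc a) (w ℤ.+ + 1) ≡ binomℤ a (w ℤ.+ + 1) ℕ.+ binomℤ a w
binomℤ-pascal a (+ m) rewrite ℕ.+-comm m 1 = C-pascal a m
binomℤ-pascal a -[1+ zero ] = ≡.refl
binomℤ-pascal a -[1+ suc d ] = ≡.refl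

[+m]-[+0]≡+m : ∀ m → + m ℤ.- + 0 ≡ + m
[+m]-[+0]≡+m m = ℤ.+-identityʳ (+ m)

[+1+m]-[+1+n]≡[+m]-[+n] : ∀ m n → + suc m ℤ.- + suc n ≡ + m ℤ.- + n
[+1+m]-[+1+n]≡[+m]-[+n] m n = begin
  + suc m ℤ.- + suc n ≡⟨ ℤ.[+m]-[+n]≡m⊖n (suc m) (suc n) ⟩
  suc m ℤ.⊖ suc n     ≡⟨ ℤ.[1+m]⊖[1+n]≡m⊖n m n ⟩
  m ℤ.⊖ n             ≡⟨ ℤ.[+m]-[+n]≡m⊖n m n ⟨
  + m ℤ.- + n         ∎
  where open ≡-Reasoning

[+m]-[+2+m+n]≡-[2+n] : ∀ m n → + m ℤ.- + suc (suc (m ℕ.+ n)) ≡ -[1+ suc n ]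
[+m]-[+2+m+n]≡-[2+n] zero    n = ≡.refl
[+m]-[+2+m+n]≡-[2+n] (suc m) n =
  ≡.trans ([+1+m]-[+1+n]≡[+m]-[+n] m (suc (suc (m ℕ.+ n)))) ([+m]-[+2+m+n]≡-[2+n] m n)

[+m]-[+1+m]≡-1 : ∀ m → + m ℤ.- + suc m ≡ -[1+ 0 ]
[+m]-[+1+m]≡-1 zero    = ≡.refl
[+m]-[+1+m]≡-1 (suc m) = ≡.trans ([+1+m]-[+1+n]≡[+m]-[+n] m (suc m)) ([+m]-[+1+m]≡-1 m)

[+m]-[+1+n]+1≡[+m]-[+n] : ∀ m n → (+ m ℤ.- + suc n) ℤ.+ + 1 ≡ + m ℤ.- + n
[+m]-[+1+n]+1≡[+m]-[+n] m n = begin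
  (+ m ℤ.- + suc n) ℤ.+ + 1 ≡⟨ cong (ℤ._+ + 1) (ℤ.[+m]-[+n]≡m⊖n m (suc n)) ⟩
  (m ℤ.⊖ suc n) ℤ.+ + 1     ≡⟨ ℤ.distribˡ-⊖-+-pos 1 m (suc n) ⟩
  (m ℕ.+ 1) ℤ.⊖ suc n       ≡⟨ cong (ℤ._⊖ suc n) (ℕ.+-comm m 1) ⟩
  suc m ℤ.⊖ suc n           ≡⟨ ℤ.[1+m]⊖[1+n]≡m⊖n m n ⟩
  m ℤ.⊖ n                   ≡⟨ ℤ.[+m]-[+n]≡m⊖n m n ⟨
  + m ℤ.- + n               ∎
  where open ≡-Reasoning

module HessenbergDeterminant {c ℓ : Level} (R : CommutativeRing c ℓ) where
  open CommutativeRing R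
  open RingDefs R
  open SetoidReasoning setoid
  open import Algebra.Properties.Ring ring using (-1*x≈-x; x[y-z]≈xy-xz)
  open import Algebra.Properties.AbelianGroup +-abelianGroup using (⁻¹-∙-comm)
  open import Algebra.Properties.CommutativeSemigroup +-commutativeSemigroup using (interchange)
  open import Algebra.Properties.Group +-group using (ε⁻¹≈ε)

  ΣFin-cong : ∀ n {f g : Fin n → Carrier} → (∀ j → f j ≈ g j) → ΣFin n f ≈ ΣFin n g
  ΣFin-cong zero    f≈g = refl
  ΣFin-cong (suc n) f≈g = +-cong (f≈g Fin.zero) (ΣFin-cong n (λ j → f≈g (Fin.suc j)))

  ΣFin-zero : ∀ n {f : Fin n → Carrier} → (∀ j → f j ≈ 0#) → ΣFin n f ≈ 0#
  ΣFin-zero zero    f≈0 = refl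
  ΣFin-zero (suc n) f≈0 =
    trans (+-cong (f≈0 Fin.zero) (ΣFin-zero n (λ j → f≈0 (Fin.suc j)))) (+-identityʳ 0#)

  det-cong : ∀ n {A B : Fin n → Fin n → Carrier} → (∀ i j → A i j ≈ B i j) → det n A ≈ det n B
  det-cong zero    A≈B = refl
  det-cong (suc n) A≈B = ΣFin-cong (suc n) λ j →
    *-congˡ {sgn (toℕ j)} (*-cong (A≈B Fin.zero j) (det-cong n (λ i j′ → A≈B (Fin.suc i) (punchIn j j′))))

  Matrix : Set c
  Matrix = ℕ → ℕ → Carrier

  leadingDet : ℕ → Matrix → Carrier
  leadingDet n A = det n (λ i j → A (toℕ i) (toℕ j))

  corner : ℕ → Matrix → Matrix
  corner t A i j = A (t ℕ.+ i) (t ℕ.+ j)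

  withColumn₀ : (ℕ → Carrier) → Matrix → Matrix
  withColumn₀ u A i zero    = u i
  withColumn₀ u A i (suc j) = A i (suc j)

  record IsUnitHessenberg (A : Matrix) : Set (c ⊔ ℓ) where
    field
      superdiagonal : ∀ i → A i (suc i) ≈ 1#
      aboveSuperdiagonal : ∀ i d → A i (suc (suc (i ℕ.+ d))) ≈ 0#

  open IsUnitHessenberg

  IsUnitHessenberg-corner₁ : ∀ {A} → IsUnitHessenberg A → IsUnitHessenberg (corner 1 A)
  IsUnitHessenberg-corner₁ h = record
    { superdiagonal      = λ i → superdiagonal h (suc i)
    ; aboveSuperdiagonal = λ i → aboveSuperdiagonal h (suc i)
    }

  -- expansion Φ u n = Σ_{t ≤ n} (-1)^t · u t · Φ t (n ∸ t)
  expansion : (ℕ → ℕ → Carrier) → (ℕ → Carrier) → ℕ → Carrier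
  expansion Φ u zero    = u 0 * Φ 0 0
  expansion Φ u (suc n) = u 0 * Φ 0 (suc n) - expansion (λ t → Φ (suc t)) (λ t → u (suc t)) n

  infixr 5 _◂_
  _◂_ : Carrier → (ℕ → Carrier) → ℕ → Carrier
  (a ◂ u) zero    = a
  (a ◂ u) (suc t) = u t

  expansion-cong : ∀ n {Φ Ψ u v} → (∀ t m → m ℕ.≤ n → Φ t m ≈ Ψ t m) → (∀ t → u t ≈ v t) →
                   expansion Φ u n ≈ expansion Ψ v n
  expansion-cong zero    Φ≈Ψ u≈v = *-cong (u≈v 0) (Φ≈Ψ 0 0 ℕ.z≤n)
  expansion-cong (suc n) Φ≈Ψ u≈v = +-cong (*-cong (u≈v 0) (Φ≈Ψ 0 (suc n) ℕ.≤-refl)) (-‿cong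
    (expansion-cong n (λ t m m≤n → Φ≈Ψ (suc t) m (ℕ.m≤n⇒m≤1+n m≤n)) (λ t → u≈v (suc t))))

  expansion-congˡ : ∀ n {Φ Ψ u} → (∀ t m → m ℕ.≤ n → Φ t m ≈ Ψ t m) → expansion Φ u n ≈ expansion Ψ u n
  expansion-congˡ n Φ≈Ψ = expansion-cong n Φ≈Ψ (λ _ → refl)

  expansion-congʳ : ∀ n Φ {u v} → (∀ t → u t ≈ v t) → expansion Φ u n ≈ expansion Φ v n
  expansion-congʳ n Φ = expansion-cong n (λ _ _ _ → refl)

  [a+b]-[c+d]≈[a-c]+[b-d] : ∀ a b c d → (a + b) - (c + d) ≈ (a - c) + (b - d)
  [a+b]-[c+d]≈[a-c]+[b-d] a b c d =
    trans (+-congˡ (sym (⁻¹-∙-comm c d))) (interchange a b (- c) (- d))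

  expansion-+ʳ : ∀ n Φ u v → expansion Φ (λ t → u t + v t) n ≈ expansion Φ u n + expansion Φ v n
  expansion-+ʳ zero    Φ u v = distribʳ _ _ _
  expansion-+ʳ (suc n) Φ u v = trans
    (+-cong (distribʳ _ _ _) (-‿cong (expansion-+ʳ n (λ t → Φ (suc t)) _ _)))
    ([a+b]-[c+d]≈[a-c]+[b-d] _ _ _ _)

  expansion-+ˡ : ∀ n Φ Ψ u → expansion (λ t m → Φ t m + Ψ t m) u n ≈ expansion Φ u n + expansion Ψ u n
  expansion-+ˡ zero    Φ Ψ u = distribˡ _ _ _
  expansion-+ˡ (suc n) Φ Ψ u = trans
    (+-cong (distribˡ _ _ _) (-‿cong (expansion-+ˡ n (λ t → Φ (suc t)) (λ t → Ψ (suc t)) _)))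
    ([a+b]-[c+d]≈[a-c]+[b-d] _ _ _ _)

  expansion-*ʳ : ∀ n Φ a u → expansion Φ (λ t → a * u t) n ≈ a * expansion Φ u n
  expansion-*ʳ zero    Φ a u = *-assoc _ _ _
  expansion-*ʳ (suc n) Φ a u = trans
    (+-cong (*-assoc _ _ _) (-‿cong (expansion-*ʳ n (λ t → Φ (suc t)) a _)))
    (sym (x[y-z]≈xy-xz a _ _))

  expansion-zeroʳ : ∀ n Φ → expansion Φ (λ _ → 0#) n ≈ 0#
  expansion-zeroʳ n Φ = trans (expansion-congʳ n Φ (λ _ → sym (zeroˡ 0#)))
                              (trans (expansion-*ʳ n Φ 0# (λ _ → 0#)) (zeroˡ _))

  expansion-unit : ∀ n Φ → expansion Φ (1# ◂ λ _ → 0#) n ≈ Φ 0 n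
  expansion-unit zero    Φ = *-identityˡ _
  expansion-unit (suc n) Φ = begin
    1# * Φ 0 (suc n) - expansion (λ t → Φ (suc t)) (λ _ → 0#) n
      ≈⟨ +-cong (*-identityˡ _) (-‿cong (expansion-zeroʳ n (λ t → Φ (suc t)))) ⟩
    Φ 0 (suc n) - 0#  ≈⟨ trans (+-congˡ ε⁻¹≈ε) (+-identityʳ _) ⟩
    Φ 0 (suc n)       ∎

  expansion-◂ : ∀ n Φ u → expansion (λ t → 0# ◂ Φ t) u (suc n) ≈ expansion Φ u n
  expansion-◂ zero    Φ u = trans (+-congˡ (trans (-‿cong (zeroʳ _)) ε⁻¹≈ε)) (+-identityʳ _)
  expansion-◂ (suc n) Φ u = +-congˡ (-‿cong (expansion-◂ n (λ t → Φ (suc t)) _))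

  minors : Matrix → ℕ → ℕ → Carrier
  minors A t m = leadingDet m (corner (suc t) A)

  -- Laplace expansion along row 0: only columns 0 and 1 survive, and the
  -- column-1 minor is again of the same shape, with first column u ∘ suc.
  det-withColumn₀ : ∀ n {A} u → IsUnitHessenberg A →
                    leadingDet (suc n) (withColumn₀ u A) ≈ expansion (minors A) u n
  det-withColumn₀ zero    u h = trans (+-identityʳ _) (*-identityˡ _)
  det-withColumn₀ (suc n) {A} u h = begin
    1# * (u 0 * X) + (- 1# * (A 0 1 * Y) + ΣFin n _)
      ≈⟨ +-cong (*-identityˡ _) (trans (+-cong (*-congˡ (*-cong (superdiagonal h 0) Y≈)) beyond≈0)
                                       (+-identityʳ _)) ⟩
    u 0 * X + - 1# * (1# * expansion (minors (corner 1 A)) (λ t → u (suc t)) n)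
      ≈⟨ +-congˡ (trans (-1*x≈-x _) (-‿cong (*-identityˡ _))) ⟩
    u 0 * X - expansion (minors (corner 1 A)) (λ t → u (suc t)) n ∎
    where
    X Y : Carrier
    X = leadingDet (suc n) (corner 1 A)
    Y = det (suc n) (λ i j → withColumn₀ u A (suc (toℕ i)) (toℕ (punchIn (Fin.suc Fin.zero) j)))
    beyond≈0 : ∀ {s f : Fin n → Carrier} → ΣFin n (λ j → s j * (A 0 (suc (suc (toℕ j))) * f j)) ≈ 0#
    beyond≈0 = ΣFin-zero n λ j →
      trans (*-congˡ (trans (*-congʳ (aboveSuperdiagonal h 0 (toℕ j))) (zeroˡ _))) (zeroʳ _)
    Y≈ : Y ≈ expansion (minors (corner 1 A)) (λ t → u (suc t)) n
    Y≈ = trans (det-cong (suc n) entry) (det-withColumn₀ n _ (IsUnitHessenberg-corner₁ h))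
      where
      entry : ∀ i j → withColumn₀ u A (suc (toℕ i)) (toℕ (punchIn (Fin.suc Fin.zero) j))
                    ≈ withColumn₀ (λ t → u (suc t)) (corner 1 A) (toℕ i) (toℕ j)
      entry i Fin.zero    = refl
      entry i (Fin.suc j) = refl

  det-unitHessenberg : ∀ n {A} → IsUnitHessenberg A →
                       leadingDet (suc n) A ≈ expansion (minors A) (λ i → A i 0) n
  det-unitHessenberg n {A} h = trans (det-cong (suc n) entry) (det-withColumn₀ n _ h)
    where
    entry : ∀ i j → A (toℕ i) (toℕ j) ≈ withColumn₀ (λ i → A i 0) A (toℕ i) (toℕ j)
    entry i Fin.zero    = refl
    entry i (Fin.suc j) = refl

module FromℕProperties {c ℓ : Level} (R : CommutativeRing c ℓ) where
  open CommutativeRing R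
  open RingDefs R
  open SetoidReasoning setoid

  fromℕ-+ : ∀ a b → fromℕ (a ℕ.+ b) ≈ fromℕ a + fromℕ b
  fromℕ-+ zero    b = sym (+-identityˡ _)
  fromℕ-+ (suc a) b = trans (+-congˡ (fromℕ-+ a b)) (sym (+-assoc _ _ _))

  fromℕ-* : ∀ a b → fromℕ (a ℕ.* b) ≈ fromℕ a * fromℕ b
  fromℕ-* zero    b = sym (zeroˡ _)
  fromℕ-* (suc a) b = begin
    fromℕ (b ℕ.+ a ℕ.* b)          ≈⟨ fromℕ-+ b (a ℕ.* b) ⟩
    fromℕ b + fromℕ (a ℕ.* b)      ≈⟨ +-cong (sym (*-identityˡ _)) (fromℕ-* a b) ⟩
    1# * fromℕ b + fromℕ a * fromℕ b ≈⟨ distribʳ _ _ _ ⟨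
    (1# + fromℕ a) * fromℕ b       ∎

module LucasRecurrence {c ℓ : Level} (R : CommutativeRing c ℓ) (k′ : ℕ) (x : CommutativeRing.Carrier R) where
  open CommutativeRing R
  open RingDefs R

  L : ℕ → Carrier
  L N = lucas (suc k′) N x

  lucasF-fuel : ∀ f g N → N ℕ.≤ f → N ℕ.≤ g → lucasF f (suc k′) N x ≡ lucasF g (suc k′) N x
  lucasF-fuel f       g       zero    _         _         = ≡.refl
  lucasF-fuel (suc f) (suc g) (suc N) (ℕ.s≤s N≤f) (ℕ.s≤s N≤g) =
    cong₂ (λ a b → if suc N ℕ.<ᵇ suc k′ then pow x (suc N) else x * a + b)
      (lucasF-fuel f g N N≤f N≤g)
      (lucasF-fuel f g (N ℕ.∸ k′) (ℕ.≤-trans (ℕ.m∸n≤m N k′) N≤f) (ℕ.≤-trans (ℕ.m∸n≤m N k′) N≤g))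

  L-rec : ∀ M → L (suc k′ ℕ.+ M) ≈ x * L (k′ ℕ.+ M) + L M
  L-rec M rewrite m+n<ᵇm≡false k′ M = +-congˡ (reflexive (≡.trans
    (cong (λ N → lucasF (k′ ℕ.+ M) (suc k′) N x) (ℕ.m+n∸m≡n k′ M))
    (lucasF-fuel (k′ ℕ.+ M) M M (ℕ.m≤n+m M k′) ℕ.≤-refl)))

  L-rec′ : ∀ {N N′} M → N ≡ suc k′ ℕ.+ M → N′ ≡ k′ ℕ.+ M → L N ≈ x * L N′ + L M
  L-rec′ M ≡.refl ≡.refl = L-rec M

  L-pow : ∀ N → suc N ℕ.< suc k′ → L (suc N) ≡ pow x (suc N)
  L-pow N N<k with suc N ℕ.<ᵇ suc k′ in eq
  ... | true  = ≡.refl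
  ... | false = contradiction (ℕ.<⇒<ᵇ N<k) (≡.subst T eq)

  L-k′ : L k′ ≈ pow x k′
  L-k′ = below k′ ≡.refl
    where
    below : ∀ j → j ≡ k′ → L j ≈ pow x j
    below zero    0≡k′  = trans (reflexive (cong (λ n → fromℕ (suc n)) (≡.sym 0≡k′))) (+-identityʳ 1#)
    below (suc j) 1+j≡k′ = reflexive (L-pow j (ℕ.s≤s (ℕ.≤-reflexive 1+j≡k′)))

module LucasDeterminant {c ℓ : Level} (R : CommutativeRing c ℓ) (k′ : ℕ) (x : CommutativeRing.Carrier R) where
  open CommutativeRing R
  open RingDefs R
  open HessenbergDeterminant R
  open FromℕProperties R
  open LucasRecurrence R k′ x
  open SetoidReasoning setoid
  open import Algebra.Properties.CommutativeSemigroup +-commutativeSemigroup using (interchange)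

  k : ℕ
  k = suc k′

  y : Carrier
  y = pow x k

  entry : ℕ → ℕ → ℤ → Carrier
  entry a b d = fromℕ (binomℤ a d) * y + fromℕ (binomℤ b (d ℤ.+ + 1))

  -- Cmat k r n x i j ≡ M r (toℕ i) (toℕ j), so det n (Cmat k r n x) ≡ F r n.
  M : ℕ → Matrix
  M r i j = entry (k ℕ.* i ℕ.+ r) (k ℕ.* suc i ℕ.+ r) (+ i ℤ.- + j)

  F : ℕ → ℕ → Carrier
  F r n = leadingDet n (M r)

  column₀ : ℕ → ℕ → Carrier
  column₀ r i = M r i 0

  -- stride q t = q + t * k, by a recursion making stride q (suc t) = stride (q + k) t definitional
  stride : ℕ → ℕ → ℕ
  stride q zero    = q
  stride q (suc t) = stride (q ℕ.+ k) t

  stride-suc : ∀ q t → stride (suc q) t ≡ suc (stride q t)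
  stride-suc q zero    = ≡.refl
  stride-suc q (suc t) = stride-suc (q ℕ.+ k) t

  strided : ℕ → ℕ → ℕ → Carrier
  strided q t = F (stride q t)

  M-shift : ∀ r i j → M r (suc i) (suc j) ≡ M (r ℕ.+ k) i j
  M-shift r i j = ≡.trans (cong₂ (λ a b → entry a b (+ suc i ℤ.- + suc j)) (shifted i) (shifted (suc i)))
                          (cong (entry _ _) ([+1+m]-[+1+n]≡[+m]-[+n] i j))
    where
    shifted : ∀ i → k ℕ.* suc i ℕ.+ r ≡ k ℕ.* i ℕ.+ (r ℕ.+ k)
    shifted i = ≡.trans (k*[1+n]+r≡k+[k*n+r] k i r) (≡.trans (ℕ.+-comm k _) (ℕ.+-assoc (k ℕ.* i) r k))

  M-isUnitHessenberg : ∀ r → IsUnitHessenberg (M r)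
  M-isUnitHessenberg r = record
    { superdiagonal = λ i → begin
        M r i (suc i)       ≡⟨ cong (entry _ _) ([+m]-[+1+m]≡-1 i) ⟩
        0# * y + (1# + 0#)  ≈⟨ +-cong (zeroˡ y) (+-identityʳ 1#) ⟩
        0# + 1#             ≈⟨ +-identityˡ 1# ⟩
        1#                  ∎
    ; aboveSuperdiagonal = λ i d → begin
        M r i (suc (suc (i ℕ.+ d)))  ≡⟨ cong (entry _ _) ([+m]-[+2+m+n]≡-[2+n] i d) ⟩
        0# * y + 0#                  ≈⟨ +-identityʳ _ ⟩
        0# * y                       ≈⟨ zeroˡ y ⟩
        0#                           ∎
    }

  fromℕ-+-entry : ∀ a₁ a₂ b₁ b₂ → fromℕ (a₁ ℕ.+ a₂) * y + fromℕ (b₁ ℕ.+ b₂)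
                  ≈ (fromℕ a₁ * y + fromℕ b₁) + (fromℕ a₂ * y + fromℕ b₂)
  fromℕ-+-entry a₁ a₂ b₁ b₂ = begin
    fromℕ (a₁ ℕ.+ a₂) * y + fromℕ (b₁ ℕ.+ b₂)
      ≈⟨ +-cong (trans (*-congʳ (fromℕ-+ a₁ a₂)) (distribʳ y _ _)) (fromℕ-+ b₁ b₂) ⟩
    (fromℕ a₁ * y + fromℕ a₂ * y) + (fromℕ b₁ + fromℕ b₂)
      ≈⟨ interchange _ _ _ _ ⟩
    (fromℕ a₁ * y + fromℕ b₁) + (fromℕ a₂ * y + fromℕ b₂) ∎

  M-pascal : ∀ s i j → M (suc s) i j ≈ M s i j + M s i (suc j)
  M-pascal s i j = begin
    M (suc s) i j  ≡⟨ cong₂ (λ A B → fromℕ A * y + fromℕ B) first second ⟩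
    fromℕ (binomℤ a d ℕ.+ binomℤ a d′) * y + fromℕ (binomℤ b (d ℤ.+ + 1) ℕ.+ binomℤ b (d′ ℤ.+ + 1))
      ≈⟨ fromℕ-+-entry (binomℤ a d) (binomℤ a d′) (binomℤ b (d ℤ.+ + 1)) (binomℤ b (d′ ℤ.+ + 1)) ⟩
    M s i j + M s i (suc j) ∎
    where
    a b : ℕ
    a = k ℕ.* i ℕ.+ s
    b = k ℕ.* suc i ℕ.+ s
    d d′ : ℤ
    d = + i ℤ.- + j
    d′ = + i ℤ.- + suc j
    d′+1≡d : d′ ℤ.+ + 1 ≡ d
    d′+1≡d = [+m]-[+1+n]+1≡[+m]-[+n] i j
    first : binomℤ (k ℕ.* i ℕ.+ suc s) d ≡ binomℤ a d ℕ.+ binomℤ a d′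
    first = ≡.trans (cong₂ binomℤ (ℕ.+-suc (k ℕ.* i) s) (≡.sym d′+1≡d))
            (≡.trans (binomℤ-pascal a d′) (cong (λ e → binomℤ a e ℕ.+ binomℤ a d′) d′+1≡d))
    second : binomℤ (k ℕ.* suc i ℕ.+ suc s) (d ℤ.+ + 1) ≡ binomℤ b (d ℤ.+ + 1) ℕ.+ binomℤ b (d′ ℤ.+ + 1)
    second = ≡.trans (cong (λ e → binomℤ e (d ℤ.+ + 1)) (ℕ.+-suc (k ℕ.* suc i) s))
             (≡.trans (binomℤ-pascal b d) (cong (λ e → binomℤ b (d ℤ.+ + 1) ℕ.+ binomℤ b e) (≡.sym d′+1≡d)))

  M-corner : ∀ r t i j → corner (suc t) (M r) i j ≡ M (stride (r ℕ.+ k) t) i j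
  M-corner r zero    i j = M-shift r i j
  M-corner r (suc t) i j = ≡.trans (M-shift r (suc (t ℕ.+ i)) (suc (t ℕ.+ j))) (M-corner (r ℕ.+ k) t i j)

  F-firstColumn : ∀ r n → F r (suc n) ≈ expansion (strided (r ℕ.+ k)) (column₀ r) n
  F-firstColumn r n = trans (det-unitHessenberg n (M-isUnitHessenberg r))
    (expansion-congˡ n λ t m _ → det-cong m λ i j → reflexive (M-corner r t (toℕ i) (toℕ j)))

  -- This is the expansion of a matrix whose first two columns coincide.
  expansion-1◂column₀≈0 : ∀ q n → expansion (strided q) (1# ◂ column₀ q) (suc n) ≈ 0#
  expansion-1◂column₀≈0 q n = begin
    1# * F q (suc n) - expansion (strided (q ℕ.+ k)) (column₀ q) n
      ≈⟨ +-congʳ (trans (*-identityˡ _) (F-firstColumn q n)) ⟩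
    expansion (strided (q ℕ.+ k)) (column₀ q) n - expansion (strided (q ℕ.+ k)) (column₀ q) n
      ≈⟨ -‿inverseʳ _ ⟩
    0# ∎

  PascalAt : ℕ → Set ℓ
  PascalAt n = ∀ s → F (suc s) (suc n) ≈ F s (suc n) + F (suc s) n

  F-suc≈F+◂ : ∀ n → (∀ {m} → m ℕ.< n → PascalAt m) →
              ∀ s m → m ℕ.≤ n → F (suc s) m ≈ F s m + (0# ◂ F (suc s)) m
  F-suc≈F+◂ n pascal s zero    _   = sym (+-identityʳ 1#)
  F-suc≈F+◂ n pascal s (suc m) m<n = pascal m<n s

  expansion-strided-suc : ∀ n → (∀ {m} → m ℕ.< n → PascalAt m) → ∀ q u →
    expansion (strided (suc q)) u n
      ≈ expansion (strided q) u n + expansion (λ t → 0# ◂ strided (suc q) t) u n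
  expansion-strided-suc n pascal q u = trans
    (expansion-congˡ n λ t m m≤n → begin
      F (stride (suc q) t) m   ≡⟨ cong (λ s → F s m) (stride-suc q t) ⟩
      F (suc (stride q t)) m   ≈⟨ F-suc≈F+◂ n pascal (stride q t) m m≤n ⟩
      F (stride q t) m + (0# ◂ F (suc (stride q t))) m
        ≡⟨ cong (λ s → F (stride q t) m + (0# ◂ F s) m) (stride-suc q t) ⟨
      F (stride q t) m + (0# ◂ strided (suc q) t) m ∎)
    (expansion-+ˡ n (strided q) (λ t → 0# ◂ strided (suc q) t) u)

  F-pascal : ∀ n → PascalAt n
  F-pascal = <-rec PascalAt step
    where
    step : ∀ n → (∀ {m} → m ℕ.< n → PascalAt m) → PascalAt n
    step n pascal s = begin
      F (suc s) (suc n)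
        ≈⟨ F-firstColumn (suc s) n ⟩
      expansion (strided (suc q)) (column₀ (suc s)) n
        ≈⟨ expansion-strided-suc n pascal q (column₀ (suc s)) ⟩
      expansion (strided q) (column₀ (suc s)) n + D
        ≈⟨ +-congʳ (trans (expansion-congʳ n (strided q) (λ t → M-pascal s t 0))
                           (expansion-+ʳ n (strided q) (column₀ s) (λ t → M s t 1))) ⟩
      (expansion (strided q) (column₀ s) n + expansion (strided q) (λ t → M s t 1) n) + D
        ≈⟨ trans (+-assoc _ _ _) (+-cong (sym (F-firstColumn s n)) (remainder n)) ⟩
      F s (suc n) + F (suc s) n ∎
      where
      q : ℕ
      q = s ℕ.+ k
      D : Carrier
      D = expansion (λ t → 0# ◂ strided (suc q) t) (column₀ (suc s)) n
      column₁≈ : ∀ t → M s t 1 ≈ (1# ◂ column₀ q) t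
      column₁≈ zero    = IsUnitHessenberg.superdiagonal (M-isUnitHessenberg s) 0
      column₁≈ (suc t) = reflexive (M-shift s t 0)
      remainder : ∀ n → expansion (strided q) (λ t → M s t 1) n
                        + expansion (λ t → 0# ◂ strided (suc q) t) (column₀ (suc s)) n ≈ F (suc s) n
      remainder zero     = trans (+-cong (trans (*-identityʳ _) (column₁≈ 0)) (zeroʳ _)) (+-identityʳ 1#)
      remainder (suc n′) = begin
        expansion (strided q) (λ t → M s t 1) (suc n′)
          + expansion (λ t → 0# ◂ strided (suc q) t) (column₀ (suc s)) (suc n′)
          ≈⟨ +-cong (trans (expansion-congʳ (suc n′) (strided q) column₁≈) (expansion-1◂column₀≈0 q n′))
                    (expansion-◂ n′ (strided (suc q)) (column₀ (suc s))) ⟩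
        0# + expansion (strided (suc q)) (column₀ (suc s)) n′
          ≈⟨ trans (+-identityˡ _) (sym (F-firstColumn (suc s) n′)) ⟩
        F (suc s) (suc n′) ∎

  column₀-binomials : ∀ r i → column₀ r i ≡ fromℕ ((k ℕ.* i ℕ.+ r) C i) * y + fromℕ ((k ℕ.* suc i ℕ.+ r) C suc i)
  column₀-binomials r i = cong₂ (λ a b → fromℕ a * y + fromℕ b)
    (cong (binomℤ (k ℕ.* i ℕ.+ r)) ([+m]-[+0]≡+m i))
    (≡.trans (cong (λ d → binomℤ (k ℕ.* suc i ℕ.+ r) (d ℤ.+ + 1)) ([+m]-[+0]≡+m i))
             (cong ((k ℕ.* suc i ℕ.+ r) C_) (ℕ.+-comm i 1)))

  column₀-zero : ∀ t → column₀ 0 t ≈ y * (1# ◂ λ _ → 0#) t + fromℕ k * (1# ◂ column₀ k′) t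
  column₀-zero zero = begin
    column₀ 0 0                        ≡⟨ column₀-binomials 0 0 ⟩
    fromℕ 1 * y + fromℕ ((k ℕ.* 1 ℕ.+ 0) C 1)
      ≈⟨ +-cong (trans (*-congʳ (+-identityʳ 1#)) (*-identityˡ y)) (reflexive (cong fromℕ kC1≡k)) ⟩
    y + fromℕ k                        ≈⟨ +-cong (*-identityʳ y) (*-identityʳ _) ⟨
    y * 1# + fromℕ k * 1#              ∎
    where
    kC1≡k : (k ℕ.* 1 ℕ.+ 0) C 1 ≡ k
    kC1≡k = ≡.trans (nC1≡n _) (≡.trans (ℕ.+-identityʳ (k ℕ.* 1)) (ℕ.*-identityʳ k))
  column₀-zero (suc t) = begin
    column₀ 0 (suc t)                  ≡⟨ column₀-binomials 0 (suc t) ⟩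
    fromℕ ((k ℕ.* suc t ℕ.+ 0) C suc t) * y + fromℕ ((k ℕ.* suc (suc t) ℕ.+ 0) C suc (suc t))
      ≡⟨ cong₂ (λ a b → fromℕ a * y + fromℕ b) ([[1+k]*[1+m]]C[1+m]≡[1+k]*[[1+k]*m+k]Cm k′ t) ([[1+k]*[1+m]]C[1+m]≡[1+k]*[[1+k]*m+k]Cm k′ (suc t)) ⟩
    fromℕ (k ℕ.* a) * y + fromℕ (k ℕ.* b)
      ≈⟨ +-cong (*-congʳ (fromℕ-* k a)) (fromℕ-* k b) ⟩
    fromℕ k * fromℕ a * y + fromℕ k * fromℕ b
      ≈⟨ trans (+-congʳ (*-assoc _ _ _)) (sym (distribˡ _ _ _)) ⟩
    fromℕ k * (fromℕ a * y + fromℕ b)  ≡⟨ cong (fromℕ k *_) (column₀-binomials k′ t) ⟨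
    fromℕ k * column₀ k′ t             ≈⟨ trans (+-congʳ (zeroʳ y)) (+-identityˡ _) ⟨
    y * 0# + fromℕ k * column₀ k′ t    ∎
    where
    a b : ℕ
    a = (k ℕ.* t ℕ.+ k′) C t
    b = (k ℕ.* suc t ℕ.+ k′) C suc t

  expansion-1◂column₀≈1 : ∀ m → expansion (strided k) (1# ◂ column₀ k′) m ≈ 1#
  expansion-1◂column₀≈1 zero    = *-identityˡ 1#
  expansion-1◂column₀≈1 (suc m) = begin
    expansion (strided k) (1# ◂ column₀ k′) (suc m)
      ≈⟨ expansion-strided-suc (suc m) (λ {j} _ → F-pascal j) k′ (1# ◂ column₀ k′) ⟩
    expansion (strided k′) (1# ◂ column₀ k′) (suc m)
      + expansion (λ t → 0# ◂ strided k t) (1# ◂ column₀ k′) (suc m)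
      ≈⟨ +-cong (expansion-1◂column₀≈0 k′ m) (expansion-◂ m (strided k) (1# ◂ column₀ k′)) ⟩
    0# + expansion (strided k) (1# ◂ column₀ k′) m
      ≈⟨ trans (+-identityˡ _) (expansion-1◂column₀≈1 m) ⟩
    1# ∎

  F-zero-suc : ∀ m → F 0 (suc m) ≈ y * F k m + fromℕ k
  F-zero-suc m = begin
    F 0 (suc m)                                         ≈⟨ F-firstColumn 0 m ⟩
    expansion (strided k) (column₀ 0) m                 ≈⟨ expansion-congʳ m (strided k) column₀-zero ⟩
    expansion (strided k) (λ t → y * (1# ◂ λ _ → 0#) t + fromℕ k * (1# ◂ column₀ k′) t) m
      ≈⟨ trans (expansion-+ʳ m (strided k) _ _) (+-cong (expansion-*ʳ m (strided k) y _) (expansion-*ʳ m (strided k) (fromℕ k) _)) ⟩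
    y * expansion (strided k) (1# ◂ λ _ → 0#) m + fromℕ k * expansion (strided k) (1# ◂ column₀ k′) m
      ≈⟨ +-cong (*-congˡ (expansion-unit m (strided k))) (trans (*-congˡ (expansion-1◂column₀≈1 m)) (*-identityʳ _)) ⟩
    y * F k m + fromℕ k ∎

  F-zero-recurrence : ∀ n → F 0 (suc (suc n)) ≈ y * F k′ (suc n) + F 0 (suc n)
  F-zero-recurrence n = begin
    F 0 (suc (suc n))                        ≈⟨ F-zero-suc (suc n) ⟩
    y * F k (suc n) + fromℕ k                ≈⟨ +-congʳ (*-congˡ (F-pascal n k′)) ⟩
    y * (F k′ (suc n) + F k n) + fromℕ k     ≈⟨ trans (+-congʳ (distribˡ y _ _)) (+-assoc _ _ _) ⟩
    y * F k′ (suc n) + (y * F k n + fromℕ k) ≈⟨ +-congˡ (F-zero-suc n) ⟨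
    y * F k′ (suc n) + F 0 (suc n)           ∎

  x^r*F≈L : ∀ n r → r ℕ.< k → pow x r * F r (suc n) ≈ L (k ℕ.* suc n ℕ.+ r)
  x^[1+r]*F≈L : ∀ n r → suc r ℕ.< k → pow x (suc r) * F (suc r) n ≈ L (k ℕ.* n ℕ.+ suc r)

  x^r*F≈L zero zero _ = begin
    1# * F 0 1                 ≈⟨ trans (*-identityˡ _) (F-zero-suc 0) ⟩
    y * 1# + fromℕ k           ≈⟨ +-congʳ (trans (*-identityʳ y) (*-congˡ (sym L-k′))) ⟩
    x * L k′ + L 0             ≈⟨ L-rec′ 0 (cong (ℕ._+ 0) (ℕ.*-identityʳ k)) (≡.sym (ℕ.+-identityʳ k′)) ⟨
    L (k ℕ.* 1 ℕ.+ 0)          ∎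
  x^r*F≈L (suc n) zero _ = begin
    1# * F 0 (suc (suc n))
      ≈⟨ trans (*-identityˡ _) (F-zero-recurrence n) ⟩
    y * F k′ (suc n) + F 0 (suc n)
      ≈⟨ +-cong (*-assoc x _ _) (sym (*-identityˡ _)) ⟩
    x * (pow x k′ * F k′ (suc n)) + 1# * F 0 (suc n)
      ≈⟨ +-cong (*-congˡ (x^r*F≈L n k′ ℕ.≤-refl)) (x^r*F≈L n 0 (ℕ.s≤s ℕ.z≤n)) ⟩
    x * L (k ℕ.* suc n ℕ.+ k′) + L (k ℕ.* suc n ℕ.+ 0)
      ≈⟨ L-rec′ (k ℕ.* suc n ℕ.+ 0) (k*[1+n]+r≡k+[k*n+r] k (suc n) 0)
                (≡.trans (ℕ.+-comm _ k′) (cong (k′ ℕ.+_) (≡.sym (ℕ.+-identityʳ _)))) ⟨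
    L (k ℕ.* suc (suc n) ℕ.+ 0) ∎
  x^r*F≈L n (suc r) r<k = begin
    pow x (suc r) * F (suc r) (suc n)                        ≈⟨ *-congˡ (F-pascal n r) ⟩
    pow x (suc r) * (F r (suc n) + F (suc r) n)              ≈⟨ trans (distribˡ _ _ _) (+-congʳ (*-assoc x _ _)) ⟩
    x * (pow x r * F r (suc n)) + pow x (suc r) * F (suc r) n
      ≈⟨ +-cong (*-congˡ (x^r*F≈L n r (ℕ.<-trans (ℕ.n<1+n r) r<k))) (x^[1+r]*F≈L n r r<k) ⟩
    x * L (k ℕ.* suc n ℕ.+ r) + L (k ℕ.* n ℕ.+ suc r)
      ≈⟨ L-rec′ (k ℕ.* n ℕ.+ suc r) (k*[1+n]+r≡k+[k*n+r] k n (suc r)) ([1+k]*[1+n]+r≡k+[[1+k]*n+[1+r]] k′ n r) ⟨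
    L (k ℕ.* suc n ℕ.+ suc r) ∎

  x^[1+r]*F≈L zero    r r<k = trans (*-identityʳ _) (reflexive (≡.trans (≡.sym (L-pow r r<k))
                                                                    (cong (λ m → L (m ℕ.+ suc r)) (≡.sym (ℕ.*-zeroʳ k)))))
  x^[1+r]*F≈L (suc n) r r<k = x^r*F≈L n (suc r) r<k

theorem3 : {c ℓ : Level} (R : CommutativeRing c ℓ) (k r n : ℕ) → 1 ≤ k → r < k → 1 ≤ n →
    (x : CommutativeRing.Carrier R) →
    CommutativeRing._≈_ R
      (CommutativeRing._*_ R (RingDefs.pow R x r) (RingDefs.det R n (RingDefs.Cmat R k r n x)))
      (RingDefs.lucas R k (k ℕ.* n ℕ.+ r) x)
theorem3 R (suc k′) r (suc n) _ r<k _ x = LucasDeterminant.x^r*F≈L R k′ x n r r<k
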